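{- Let $G_n$, $m$, $T$ be as in the context. A minimal walk in $G_n$ is an Eulerian cycle of $G_n$ if and only if $T$ is a tree (i.e., $T$ contains no directed cycle, so that every vertex has a directed path in $T$ to $m$).
   Context: Let $A$ be a finite alphabet with a linear order $<$, extended to words by the lexicographic (alphabetic) order: $x<y$ if $x$ is a proper prefix of $y$, or $x=uav$, $y=ubw$ with $a,b\in A$, $a<b$. Let $\mathcal{F}$ be a set of words over $A$ (forbidden factors). A word $w$ is said to be in the language if the bi-infinite periodic word $\cdots www\cdots$ contains no word of $\mathcal{F}$ as a factor; $W_k$ denotes the set of words of length $k$ in the language. Fix $n\ge 1$. Consider the digraph with vertex set $A^n$ having an arc from $as$ to $sb$ ($a,b\in A$, $s\in A^{n-1}$) whenever $asb\in W_{n+1}$; this arc has label $b$. The de Bruijn graph $G_n$ is a strongly connected component of this digraph with the maximum number of vertices (unique when the subshift defined by $\mathcal{F}$ is irreducible). Vertices are identified with their words. Let $m=m_1\cdots m_n$ be the vertex of $G_n$ that is maximal in lexicographic order. For each vertex $v$ let $e(v)$ be the arc of $G_n$ with tail $v$ having maximum label. $T$ is the spanning subgraph of $G_n$ with arc set $\{e(v): v\in V(G_n), v\neq m\}$. A minimal walk is the walk in $G_n$ that starts at $m$ and, at each vertex, continues along the arc of smallest label among the not-yet-used arcs with tail at the current vertex, stopping when no unused arc leaves the current vertex. An Eulerian cycle is a closed walk using every arc of $G_n$ exactly once. -}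

module Defs where

open import Data.Nat using (ℕ; zero; suc; _+_; _≤_)
open import Data.Nat.DivMod using (_mod_)
open import Data.Fin using (Fin; toℕ)
import Data.Fin as F
open import Data.List using (List; []; _∷_; _++_; [_]; length; lookup; map; concatMap; allFin; filterᵇ; drop)
open import Data.List.Membership.Propositional using (_∈_; _∉_)
open import Data.List.Relation.Unary.Unique.Propositional using (Unique)
open import Data.List.Relation.Binary.Lex.Strict using (Lex-<)
open import Data.Product using (Σ; ∃; _×_; _,_)
open import Data.Bool using (Bool; true)
open import Data.Empty using (⊥)
open import Data.Unit using (⊤)
open import Relation.Nullary using (¬_)
open import Relation.Binary.PropositionalEquality using (_≡_; _≢_)
open import Relation.Binary.Construct.Closure.ReflexiveTransitive using (Star)
open import Relation.Binary.Construct.Closure.Transitive using (TransClosure)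

module _ {k : ℕ} where

  -- The alphabet A is Fin k with its natural linear order.
  Word : Set
  Word = List (Fin k)

  _<lex_ : Word → Word → Set
  _<lex_ = Lex-< _≡_ F._<_

  per : Fin k → Word → ℕ → Fin k
  per a as i = lookup (a ∷ as) (i mod suc (length as))

  -- f occurs as a factor of the periodic word ⋯www⋯ (w = a ∷ as).
  -- (Every factor of the bi-infinite periodic word starts, up to a
  -- multiple of the period, at some nonnegative position.)
  OccursIn : Word → Fin k → Word → Set
  OccursIn f a as = ∃ λ (i : ℕ) → (t : Fin (length f)) → lookup f t ≡ per a as (i + toℕ t)

  InLang : List Word → Word → Set
  InLang 𝓕 [] = ⊤
  InLang 𝓕 (a ∷ as) = (f : Word) → f ∈ 𝓕 → ¬ OccursIn f a as

  InW : List Word → ℕ → Word → Set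
  InW 𝓕 j w = length w ≡ j × InLang 𝓕 w

  Arc : List Word → ℕ → Word → Word → Set
  Arc 𝓕 n u v = ∃ λ (a : Fin k) → ∃ λ (s : Word) → ∃ λ (b : Fin k) →
    u ≡ a ∷ s × v ≡ s ++ [ b ] × length u ≡ n × InW 𝓕 (suc n) (a ∷ s ++ [ b ])

  Reach : List Word → ℕ → Word → Word → Set
  Reach 𝓕 n = Star (Arc 𝓕 n)

  allWords : ℕ → List Word
  allWords zero = [ [] ]
  allWords (suc j) = concatMap (λ w → map (λ a → a ∷ w) (allFin k)) (allWords j)

  size : ℕ → (Word → Bool) → ℕ
  size n G = length (filterᵇ G (allWords n))

  IsSCC : List Word → ℕ → (Word → Bool) → Set
  IsSCC 𝓕 n G =
    (∀ u → G u ≡ true → length u ≡ n) ×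
    (∃ λ u → G u ≡ true) ×
    (∀ u v → G u ≡ true → G v ≡ true → Reach 𝓕 n u v) ×
    (∀ u v → G u ≡ true → Reach 𝓕 n u v → Reach 𝓕 n v u → G v ≡ true)

  IsDeBruijn : List Word → ℕ → (Word → Bool) → Set
  IsDeBruijn 𝓕 n G = IsSCC 𝓕 n G × (∀ H → IsSCC 𝓕 n H → size n H ≤ size n G)

  IsLexMax : (Word → Bool) → Word → Set
  IsLexMax G m = G m ≡ true × (∀ v → G v ≡ true → v ≢ m → v <lex m)

  -- Arcs of G_n are represented as (tail , label); head of (u , b) is s b where u = a s.
  ArcT : Set
  ArcT = Word × Fin k

  head : Word → Fin k → Word
  head u b = drop 1 u ++ [ b ]

  ArcG : List Word → ℕ → (Word → Bool) → Word → Fin k → Set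
  ArcG 𝓕 n G u b = G u ≡ true × G (head u b) ≡ true × Arc 𝓕 n u (head u b)

  TArc : List Word → ℕ → (Word → Bool) → Word → Word → Word → Set
  TArc 𝓕 n G m u v = ∃ λ (b : Fin k) →
    u ≢ m × ArcG 𝓕 n G u b × (∀ b′ → ArcG 𝓕 n G u b′ → b′ F.≤ b) × v ≡ head u b

  IsTree : List Word → ℕ → (Word → Bool) → Word → Set
  IsTree 𝓕 n G m = ¬ (∃ λ u → TransClosure (TArc 𝓕 n G m) u u)

  data MinWalkFrom (𝓕 : List Word) (n : ℕ) (G : Word → Bool) :
       List ArcT → Word → List ArcT → Set where
    stop : ∀ {used v} → (∀ b → ArcG 𝓕 n G v b → (v , b) ∈ used) →
           MinWalkFrom 𝓕 n G used v []
    step : ∀ {used v b ws} → ArcG 𝓕 n G v b → (v , b) ∉ used →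
           (∀ b′ → ArcG 𝓕 n G v b′ → (v , b′) ∉ used → b F.≤ b′) →
           MinWalkFrom 𝓕 n G ((v , b) ∷ used) (head v b) ws →
           MinWalkFrom 𝓕 n G used v ((v , b) ∷ ws)

  IsMinimalWalk : List Word → ℕ → (Word → Bool) → Word → List ArcT → Set
  IsMinimalWalk 𝓕 n G m ws = MinWalkFrom 𝓕 n G [] m ws

  data Walk (𝓕 : List Word) (n : ℕ) (G : Word → Bool) : Word → List ArcT → Word → Set where
    nil  : ∀ {v} → Walk 𝓕 n G v [] v
    cons : ∀ {u b ws w} → ArcG 𝓕 n G u b → Walk 𝓕 n G (head u b) ws w →
           Walk 𝓕 n G u ((u , b) ∷ ws) w

  IsEulerianCycle : List Word → ℕ → (Word → Bool) → List ArcT → Set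
  IsEulerianCycle 𝓕 n G ws =
    (∃ λ v → G v ≡ true × Walk 𝓕 n G v ws v) ×
    Unique ws ×
    (∀ u b → ArcG 𝓕 n G u b → (u , b) ∈ ws)

module Submission where

--  * Generic facts: a repetition-free list contained in ys is no longer than
--    ys; an acyclic relation has no nonempty successor-closed subset of a
--    finite set; a decidable predicate on Fin k has a greatest witness.
--  * Periodic words: every window of ⋯www⋯ lies in the language.  Hence every
--    arc a s → s b lies on a cycle (so an arc leaving a vertex of G_n is an
--    arc of G_n) and is followed by the arc s b → s b a ("rotation").
--  * Rotation injects the arcs entering y into those leaving y.  So a
--    repetition-free list of arcs containing every arc leaving y has at least
--    as many arcs leaving y as entering y, strictly more if an arc entering y
--    is missing.
--  * Hence the minimal walk from m returns to m, entering and leaving every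
--    vertex equally often.  (⇐) At a vertex x with an unused arc, e(x) is
--    unused and leads to another such vertex, so T would contain an infinite
--    path in a finite set.  (⇒) If every arc is used, then along an arc x → y
--    of T the last exit of the walk from y comes strictly after the last exit
--    from x, so T has no cycle.

open import Defs
open import Data.Nat using (ℕ; zero; suc; _+_; _≤_; _<_; z≤n; s≤s; _%_; NonZero)
import Data.Nat.Properties as ℕP
open import Data.Nat.DivMod using (_mod_; m%n<n; %-distribˡ-+; m%n%n≡m%n; m<n⇒m%n≡m; [m+n]%n≡m%n)
open import Data.Fin using (Fin; toℕ) renaming (zero to fzero; suc to fsuc)
import Data.Fin as F
import Data.Fin.Properties as FinP
open import Data.Bool using (Bool; true)
import Data.Bool.Properties as BoolP
open import Data.List using (List; []; _∷_; _++_; [_]; length; lookup; map; filter; drop; allFin)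
import Data.List.Properties as ListP
open import Data.List.Membership.Propositional using (_∈_; _∉_)
open import Data.List.Membership.Propositional.Properties
  using (∈-∃++; ∈-++⁺ˡ; ∈-++⁺ʳ; ∈-filter⁺; ∈-filter⁻; ∈-map⁻; ∈-map⁺; ∈-concat⁺′; ∈-allFin)
open import Data.List.Relation.Binary.Subset.Propositional using (_⊆_)
open import Data.List.Relation.Unary.Unique.Propositional using (Unique)
import Data.List.Relation.Unary.Unique.Propositional.Properties as UniqueP
open import Data.List.Relation.Unary.AllPairs as AllPairs using (AllPairs; []; _∷_)
open import Data.List.Relation.Unary.All as All using (All; []; _∷_)
open import Data.List.Relation.Unary.Any using (here; there)
import Data.List.Relation.Unary.Any as Any
open import Data.Product using (Σ; ∃; ∃₂; _×_; _,_; proj₁; proj₂)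
import Data.Product.Properties as ProductP
open import Data.Sum using (_⊎_; inj₁; inj₂)
open import Data.Empty using (⊥-elim)
open import Data.Unit using (tt)
open import Function.Bundles using (_⇔_; mk⇔)
open import Relation.Nullary using (¬_; Dec; yes; no; ¬?)
open import Relation.Nullary.Decidable using (_×-dec_; map′)
open import Relation.Unary using (Decidable)
open import Relation.Binary.PropositionalEquality
  using (_≡_; _≢_; refl; sym; trans; cong; cong₂; subst; subst₂; module ≡-Reasoning)
open import Relation.Binary.Construct.Closure.ReflexiveTransitive using (ε; _◅_)
open import Relation.Binary.Construct.Closure.Transitive
  using (TransClosure; _∷ʳ_) renaming ([_] to [_]⁺; _∷_ to _∷⁺_)

module _ {A : Set} where

  ∈-delete : ∀ (ys₁ ys₂ : List A) {z w : A} → w ∈ ys₁ ++ z ∷ ys₂ → w ≢ z → w ∈ ys₁ ++ ys₂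
  ∈-delete []        ys₂ (here w≡z) w≢z = ⊥-elim (w≢z w≡z)
  ∈-delete []        ys₂ (there w∈) w≢z = w∈
  ∈-delete (y ∷ ys₁) ys₂ (here w≡y) _   = here w≡y
  ∈-delete (y ∷ ys₁) ys₂ (there w∈) w≢z = there (∈-delete ys₁ ys₂ w∈ w≢z)

  unique⊆⇒length≤ : ∀ {xs ys : List A} → Unique xs → xs ⊆ ys → length xs ≤ length ys
  unique⊆⇒length≤ {[]}     _             _   = z≤n
  unique⊆⇒length≤ {x ∷ xs} (x∉xs ∷ xs!) sub with ∈-∃++ (sub (here refl))
  ... | ys₁ , ys₂ , refl =
    subst (suc (length xs) ≤_) (sym (ListP.length-++-sucʳ ys₁ x ys₂))
      (s≤s (unique⊆⇒length≤ xs! (λ z∈ → ∈-delete ys₁ ys₂ (sub (there z∈))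
                                            (λ { refl → All.lookup x∉xs z∈ refl }))))

  unique⊆⇒length< : ∀ {xs ys : List A} {y : A} → Unique xs → xs ⊆ ys → y ∈ ys → y ∉ xs →
                    length xs < length ys
  unique⊆⇒length< {xs} xs! sub y∈ys y∉xs =
    unique⊆⇒length≤ (All.tabulate (λ z∈ y≡z → y∉xs (subst (_∈ xs) (sym y≡z) z∈)) ∷ xs!)
                     λ { (here refl) → y∈ys ; (there z∈) → sub z∈ }

  suffix-⊆ : ∀ (p₁ s₁ p₂ s₂ : List A) → p₁ ++ s₁ ≡ p₂ ++ s₂ → length s₁ ≤ length s₂ → s₁ ⊆ s₂
  suffix-⊆ p₁       s₁ []       s₂ refl _  = ∈-++⁺ʳ p₁
  suffix-⊆ []       s₁ (z ∷ p₂) s₂ refl le = ⊥-elim (ℕP.<⇒≱ le (ListP.length-++-≤ʳ s₂ {p₂}))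
  suffix-⊆ (_ ∷ p₁) s₁ (_ ∷ p₂) s₂ eq   le = suffix-⊆ p₁ s₁ p₂ s₂ (ListP.∷-injectiveʳ eq) le

  unique-suffix : ∀ (pre post : List A) → Unique (pre ++ post) → Unique post
  unique-suffix []        post post!       = post!
  unique-suffix (_ ∷ pre) post (_ ∷ rest!) = unique-suffix pre post rest!

  unique-∉-after : ∀ (pre post : List A) {a : A} → Unique (pre ++ a ∷ post) → a ∉ post
  unique-∉-after pre post ws! with unique-suffix pre _ ws!
  ... | a∉post ∷ _ = λ a∈ → All.lookup a∉post a∈ refl

  unique-∉-before : ∀ (pre post : List A) {y : A} → Unique (pre ++ post) → y ∈ post → y ∉ pre
  unique-∉-before (x ∷ pre) post (x∉ ∷ _) y∈ (here refl) = All.lookup x∉ (∈-++⁺ʳ pre y∈) refl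
  unique-∉-before (x ∷ pre) post (_ ∷ rest!) y∈ (there y∈pre) = unique-∉-before pre post rest! y∈ y∈pre

allWords-complete : ∀ {k} (w : Word {k}) → w ∈ allWords (length w)
allWords-complete []      = here refl
allWords-complete {k} (a ∷ w) =
  ∈-concat⁺′ (∈-map⁺ (_∷ w) (∈-allFin a)) (∈-map⁺ (λ v → map (_∷ v) (allFin k)) (allWords-complete w))

module _ {A : Set} (T : A → A → Set) (acyclic : ∀ {u} → ¬ TransClosure T u u) where

  private
    _⁺←_ : A → A → Set
    z ⁺← y = TransClosure T y z

  -- If every element satisfying P has a T-successor satisfying P, and P is
  -- contained in a finite list, then P is empty: otherwise one could follow
  -- T for longer than the list without repeating an element.
  successor-closed⇒empty : (P : A → Set) (V : List A) → (∀ {x} → P x → x ∈ V) →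
                           (∀ {x} → P x → ∃ λ y → T x y × P y) → ∀ {x} → ¬ P x
  successor-closed⇒empty P V P⊆V next {x} px = ℕP.<-irrefl refl (long-path-fits (path (length V)))
    where
      -- A T-path with j + 1 vertices inside P, listed from its last vertex backwards.
      Path : ℕ → Set
      Path j = ∃₂ λ cur xs → length xs ≡ j × All P (cur ∷ xs) × AllPairs _⁺←_ (cur ∷ xs)

      path : ∀ j → Path j
      path zero = x , [] , refl , px ∷ [] , [] ∷ []
      path (suc j) with path j
      ... | cur , xs , len , Pcur ∷ Pxs , cur← ∷ xs← with next Pcur
      ...   | y , cur→y , Py =
        y , cur ∷ xs , cong suc len , Py ∷ Pcur ∷ Pxs ,
        ([ cur→y ]⁺ ∷ All.map (_∷ʳ cur→y) cur←) ∷ cur← ∷ xs←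

      long-path-fits : ∀ {j} → Path j → suc j ≤ length V
      long-path-fits (_ , _ , refl , Ps , desc) =
        unique⊆⇒length≤ (AllPairs.map (λ { z⁺←w refl → acyclic z⁺←w }) desc)
                         (λ z∈ → P⊆V (All.lookup Ps z∈))

greatest-witness : ∀ {k} {P : Fin k → Set} → Decidable P → ∃ P →
                   ∃ λ b → P b × (∀ b′ → P b′ → b′ F.≤ b)
greatest-witness {suc k} {P} P? ∃P with FinP.any? (λ j → P? (fsuc j))
... | yes ∃Psuc with greatest-witness (λ j → P? (fsuc j)) ∃Psuc
...   | b , Pb , greatest = fsuc b , Pb , below
  where
    below : ∀ b′ → P b′ → b′ F.≤ fsuc b
    below fzero     _   = z≤n
    below (fsuc b′) Pb′ = s≤s (greatest b′ Pb′)
greatest-witness {suc k} {P} P? (fzero , P0) | no ¬∃Psuc = fzero , P0 , below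
  where
    below : ∀ b′ → P b′ → b′ F.≤ fzero {k}
    below fzero     _   = z≤n
    below (fsuc b′) Pb′ = ⊥-elim (¬∃Psuc (b′ , Pb′))
greatest-witness P? (fsuc j , Pj) | no ¬∃Psuc = ⊥-elim (¬∃Psuc (j , Pj))

module PeriodicWords {k : ℕ} where

  per-cong : ∀ (a : Fin k) as y z → y % suc (length as) ≡ z % suc (length as) →
             per a as y ≡ per a as z
  per-cong a as y z eq = cong (lookup (a ∷ as))
    (FinP.toℕ-injective (trans (FinP.toℕ-fromℕ< _) (trans eq (sym (FinP.toℕ-fromℕ< _)))))

  per-first-period : ∀ (a : Fin k) as (t : Fin (length (a ∷ as))) → per a as (toℕ t) ≡ lookup (a ∷ as) t
  per-first-period a as t = cong (lookup (a ∷ as))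
    (FinP.toℕ-injective (trans (FinP.toℕ-fromℕ< _) (m<n⇒m%n≡m (FinP.toℕ<n t))))

  per-periodic : ∀ (a : Fin k) as t → per a as (suc (length as) + t) ≡ per a as t
  per-periodic a as t = per-cong a as (L + t) t (trans (cong (_% L) (ℕP.+-comm L t)) ([m+n]%n≡m%n t L))
    where L = suc (length as)

  %-absorbʳ : ∀ j x L .{{_ : NonZero L}} → (j + x % L) % L ≡ (j + x) % L
  %-absorbʳ j x L = trans (%-distribˡ-+ j (x % L) L)
    (trans (cong (λ y → (j % L + y) % L) (m%n%n≡m%n x L)) (sym (%-distribˡ-+ j x L)))

  %-absorbˡ : ∀ x j L .{{_ : NonZero L}} → (x % L + j) % L ≡ (x + j) % L
  %-absorbˡ x j L = trans (cong (_% L) (ℕP.+-comm (x % L) j))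
    (trans (%-absorbʳ j x L) (cong (_% L) (ℕP.+-comm j x)))

  window : (ℕ → Fin k) → ℕ → ℕ → Word {k}
  window P j zero    = []
  window P j (suc l) = P j ∷ window P (suc j) l

  window-length : ∀ P j l → length (window P j l) ≡ l
  window-length P j zero    = refl
  window-length P j (suc l) = cong suc (window-length P (suc j) l)

  window-snoc : ∀ P j l → window P j (suc l) ≡ window P j l ++ [ P (j + l) ]
  window-snoc P j zero    = cong (λ x → P x ∷ []) (sym (ℕP.+-identityʳ j))
  window-snoc P j (suc l) = cong (P j ∷_)
    (trans (window-snoc P (suc j) l) (cong (λ x → window P (suc j) l ++ [ P x ]) (sym (ℕP.+-suc j l))))

  window-lookup : ∀ P j l (t : Fin (length (window P j l))) → lookup (window P j l) t ≡ P (j + toℕ t)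
  window-lookup P j (suc l) fzero    = cong P (sym (ℕP.+-identityʳ j))
  window-lookup P j (suc l) (fsuc t) =
    trans (window-lookup P (suc j) l t) (cong P (sym (ℕP.+-suc j (toℕ t))))

  window-cong : ∀ P j j′ l → (∀ t → P (j + t) ≡ P (j′ + t)) → window P j l ≡ window P j′ l
  window-cong P j j′ zero    _ = refl
  window-cong P j j′ (suc l) h = cong₂ _∷_
    (trans (cong P (sym (ℕP.+-identityʳ j))) (trans (h 0) (cong P (ℕP.+-identityʳ j′))))
    (window-cong P (suc j) (suc j′) l
      (λ t → trans (cong P (sym (ℕP.+-suc j t))) (trans (h (suc t)) (cong P (ℕP.+-suc j′ t)))))

  window-reads : ∀ P j (xs : Word {k}) → (∀ (t : Fin (length xs)) → P (j + toℕ t) ≡ lookup xs t) →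
                 window P j (length xs) ≡ xs
  window-reads P j []       _ = refl
  window-reads P j (x ∷ xs) h = cong₂ _∷_ (trans (cong P (sym (ℕP.+-identityʳ j))) (h fzero))
    (window-reads P (suc j) xs (λ t → trans (cong P (sym (ℕP.+-suc j (toℕ t)))) (h (fsuc t))))

  per-window : ∀ (a : Fin k) as j x →
               per (per a as j) (window (per a as) (suc j) (length as)) x ≡ per a as (j + x)
  per-window a as j x =
    trans (window-lookup P j (suc l) (x mod suc (length (window P (suc j) l))))
      (per-cong a as (j + toℕ (x mod suc (length (window P (suc j) l)))) (j + x)
                     (trans (cong (λ y → (j + y) % suc l)
                                  (trans (FinP.toℕ-fromℕ< _)
                                         (cong (λ q → x % suc q) (window-length P (suc j) l))))
                            (%-absorbʳ j x (suc l))))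
    where P = per a as
          l = length as

  window-in-language : ∀ (𝓕 : List (Word {k})) (a : Fin k) as → InLang 𝓕 (a ∷ as) → ∀ j →
                       InLang 𝓕 (window (per a as) j (suc (length as)))
  window-in-language 𝓕 a as w∈L j f f∈𝓕 (i , occ) = w∈L f f∈𝓕 (j + i , λ t →
    trans (occ t) (trans (per-window a as j (i + toℕ t)) (cong (per a as) (sym (ℕP.+-assoc j i (toℕ t))))))

  -- Occurrences of a factor may be assumed to start within the first period,
  -- which makes membership in the language decidable.
  module _ (f : Word {k}) (a : Fin k) (as : Word {k}) where
    private
      L = suc (length as)

    OccursEarly : Set
    OccursEarly = Σ (Fin L) λ i → (t : Fin (length f)) → lookup f t ≡ per a as (toℕ i + toℕ t)

    occurs⇒early : OccursIn f a as → OccursEarly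
    occurs⇒early (i , occ) = i mod L , λ t → trans (occ t) (per-cong a as (i + toℕ t) (toℕ (i mod L) + toℕ t)
      (trans (sym (%-absorbˡ i (toℕ t) L))
             (cong (λ y → (y + toℕ t) % L) (sym (FinP.toℕ-fromℕ< (m%n<n i L))))))

    occurs? : Dec (OccursIn f a as)
    occurs? = map′ (λ { (i , occ) → toℕ i , occ }) occurs⇒early
      (FinP.any? (λ i → FinP.all? (λ t → lookup f t F.≟ per a as (toℕ i + toℕ t))))

  inLang? : ∀ (𝓕 : List (Word {k})) w → Dec (InLang 𝓕 w)
  inLang? 𝓕 []       = yes tt
  inLang? 𝓕 (a ∷ as) = map′ (λ none f f∈ → All.lookup none f∈) (λ h → All.tabulate (λ {f} → h f))
                             (All.all? (λ f → ¬? (occurs? f a as)) 𝓕)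

  arc? : ∀ (𝓕 : List (Word {k})) n u b → Dec (Arc 𝓕 n u (head u b))
  arc? 𝓕 n []      b = no λ { (_ , _ , _ , () , _) }
  arc? 𝓕 n (a ∷ s) b with (length (a ∷ s) ℕP.≟ n)
                          ×-dec ((length (a ∷ s ++ [ b ]) ℕP.≟ suc n) ×-dec inLang? 𝓕 (a ∷ s ++ [ b ]))
  ... | yes (len , w∈W) = yes (a , s , b , refl , refl , len , w∈W)
  ... | no ¬arc = no λ { (_ , _ , b′ , refl , s++b≡ , len , w∈W) →
          ¬arc (len , subst (λ c → InW 𝓕 (suc n) (a ∷ s ++ [ c ]))
                            (sym (ListP.∷ʳ-injectiveʳ s s s++b≡)) w∈W) }

module Arcs {k : ℕ} (𝓕 : List (Word {k})) (n′ : ℕ) where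
  open PeriodicWords

  N : ℕ
  N = suc n′

  module Windows (a : Fin k) (as : Word {k}) (w∈L : InLang 𝓕 (a ∷ as)) (len : length as ≡ N) where
    P : ℕ → Fin k
    P = per a as

    window-arc : ∀ j → Arc 𝓕 N (window P j N) (window P (suc j) N)
    window-arc j = P j , window P (suc j) n′ , P (suc j + n′) , refl , window-snoc P (suc j) n′ ,
      window-length P j N ,
      subst (InW 𝓕 (suc N)) (cong (P j ∷_) (window-snoc P (suc j) n′))
        (subst (λ l → InW 𝓕 (suc l) (window P j (suc l))) len
          (window-length P j (suc (length as)) , window-in-language 𝓕 a as w∈L j))

    window-reach : ∀ d j → Reach 𝓕 N (window P j N) (window P (d + j) N)
    window-reach zero    j = ε
    window-reach (suc d) j = window-arc j ◅
      subst (λ x → Reach 𝓕 N (window P (suc j) N) (window P x N)) (ℕP.+-suc d j) (window-reach d (suc j))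

    periodic : ∀ t → P (suc N + t) ≡ P t
    periodic t = subst (λ l → P (suc l + t) ≡ P t) len (per-periodic a as t)

    wrap-around : window P (N + 1) N ≡ window P 0 N
    wrap-around = window-cong P (N + 1) 0 N (λ t → trans (cong (λ x → P (x + t)) (ℕP.+-comm N 1)) (periodic t))

    first-window : window P 0 (suc N) ≡ a ∷ as
    first-window = trans (cong (λ l → window P 0 (suc l)) (sym len))
                         (window-reads P 0 (a ∷ as) (per-first-period a as))

    second-window : window P 1 N ≡ as
    second-window = ListP.∷-injectiveʳ first-window

  private
    arc-length : ∀ {a : Fin k} s b → length (a ∷ s) ≡ N → length (s ++ [ b ]) ≡ N
    arc-length s b len = trans (ListP.length-++ s) (trans (ℕP.+-comm (length s) 1) len)

  -- Every arc lies on a cycle: from s b one returns to a s along the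
  -- consecutive windows of the periodic word ⋯(a s b)(a s b)⋯.
  arc-returns : ∀ {u v} → Arc 𝓕 N u v → Reach 𝓕 N v u
  arc-returns (a , s , b , refl , refl , len , _ , w∈L) =
    subst₂ (Reach 𝓕 N) second-window (trans wrap-around first-window-init) (window-reach N 1)
    where
      open Windows a (s ++ [ b ]) w∈L (arc-length {a} s b len)
      first-window-init : window P 0 N ≡ a ∷ s
      first-window-init = proj₁ (ListP.∷ʳ-injective (window P 0 N) (a ∷ s)
                                  (trans (sym (window-snoc P 0 N)) first-window))

  -- The arc a s → s b is followed by the arc s b → s b a: its word s b a is
  -- the window at position 1 of ⋯(a s b)(a s b)⋯.
  arc-rotates : ∀ {c s v} → Arc 𝓕 N (c ∷ s) v → Arc 𝓕 N v (head v c)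
  arc-rotates (a , s , b , refl , refl , len , _ , w∈L) =
    subst₂ (Arc 𝓕 N) second-window third-window (window-arc 1)
    where
      open Windows a (s ++ [ b ]) w∈L (arc-length {a} s b len)
      third-window : window P 2 N ≡ head (s ++ [ b ]) a
      third-window = trans (window-snoc P 2 n′)
        (cong₂ (λ x y → x ++ [ y ]) (cong (drop 1) second-window)
               (trans (cong P (sym (ℕP.+-identityʳ (suc N)))) (periodic 0)))

⟦_⟧ : ∀ {P : Set} → Dec P → ℕ
⟦ yes _ ⟧ = 1
⟦ no _ ⟧ = 0

⟦⟧-yes : ∀ {P : Set} (d : Dec P) → P → ⟦ d ⟧ ≡ 1
⟦⟧-yes (yes _) _ = refl
⟦⟧-yes (no ¬p) p = ⊥-elim (¬p p)

⟦⟧-no : ∀ {P : Set} (d : Dec P) → ¬ P → ⟦ d ⟧ ≡ 0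
⟦⟧-no (yes p) ¬p = ⊥-elim (¬p p)
⟦⟧-no (no _)  _  = refl

length-filter-∷ : ∀ {A : Set} {P : A → Set} (P? : Decidable P) a as →
                  length (filter P? (a ∷ as)) ≡ ⟦ P? a ⟧ + length (filter P? as)
length-filter-∷ P? a as with P? a
... | yes _ = refl
... | no _  = refl

module Walks {k : ℕ} (𝓕 : List (Word {k})) (n : ℕ) (G : Word {k} → Bool) where

  _≟w_ : (x y : Word {k}) → Dec (x ≡ y)
  _≟w_ = ListP.≡-dec FinP._≟_

  target : ArcT {k} → Word {k}
  target (t , b) = head t b

  IsArc : ArcT {k} → Set
  IsArc (t , b) = ArcG 𝓕 n G t b

  leaving : Word {k} → List (ArcT {k}) → List (ArcT {k})
  leaving x = filter (λ a → proj₁ a ≟w x)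

  entering : Word {k} → List (ArcT {k}) → List (ArcT {k})
  entering x = filter (λ a → target a ≟w x)

  walk-balance : ∀ {u ws w} → Walk 𝓕 n G u ws w → ∀ x →
    length (leaving x ws) + ⟦ w ≟w x ⟧ ≡ length (entering x ws) + ⟦ u ≟w x ⟧
  walk-balance nil x = refl
  walk-balance {u} {(u , b) ∷ ws} {w} (cons _ rest) x = begin
    length (leaving x ((u , b) ∷ ws)) + ⟦ w ≟w x ⟧
      ≡⟨ cong (_+ ⟦ w ≟w x ⟧) (length-filter-∷ (λ a → proj₁ a ≟w x) (u , b) ws) ⟩
    (out₀ + length (leaving x ws)) + ⟦ w ≟w x ⟧
      ≡⟨ ℕP.+-assoc out₀ _ _ ⟩
    out₀ + (length (leaving x ws) + ⟦ w ≟w x ⟧)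
      ≡⟨ cong (out₀ +_) (walk-balance rest x) ⟩
    out₀ + (length (entering x ws) + in₀)
      ≡⟨ ℕP.+-comm out₀ _ ⟩
    (length (entering x ws) + in₀) + out₀
      ≡⟨ cong (_+ out₀) (ℕP.+-comm (length (entering x ws)) in₀) ⟩
    (in₀ + length (entering x ws)) + out₀
      ≡⟨ cong (_+ out₀) (length-filter-∷ (λ a → target a ≟w x) (u , b) ws) ⟨
    length (entering x ((u , b) ∷ ws)) + ⟦ u ≟w x ⟧ ∎
    where
      open ≡-Reasoning
      out₀ = ⟦ u ≟w x ⟧
      in₀ = ⟦ head u b ≟w x ⟧

  walk-arcs : ∀ {u ws w} → Walk 𝓕 n G u ws w → ∀ {a} → a ∈ ws → IsArc a
  walk-arcs (cons a-arc _) (here refl) = a-arc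
  walk-arcs (cons _ rest)  (there a∈)  = walk-arcs rest a∈

  walk-suffix : ∀ {u w} pre {x b} post → Walk 𝓕 n G u (pre ++ (x , b) ∷ post) w →
                Walk 𝓕 n G (head x b) post w
  walk-suffix []        post (cons _ rest) = rest
  walk-suffix (_ ∷ pre) post (cons _ rest) = walk-suffix pre post rest

  walk-leaves : ∀ {u ws w} → Walk 𝓕 n G u ws w → u ≢ w → ∃ λ b → (u , b) ∈ ws
  walk-leaves nil                 u≢u = ⊥-elim (u≢u refl)
  walk-leaves (cons {b = b} _ _) _   = b , here refl

  min-walk-end : ∀ {used v ws} → MinWalkFrom 𝓕 n G used v ws →
    ∃ λ e → Walk 𝓕 n G v ws e × (∀ b → ArcG 𝓕 n G e b → (e , b) ∈ ws ⊎ (e , b) ∈ used)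
  min-walk-end {v = v} (stop all-used) = v , nil , λ b e-arc → inj₂ (all-used b e-arc)
  min-walk-end (step v-arc _ _ rest) with min-walk-end rest
  ... | e , walk , e-used = e , cons v-arc walk , λ b e-arc → shift (e-used b e-arc)
    where
      shift : ∀ {z} → z ∈ _ ⊎ z ∈ _ → z ∈ _ ⊎ z ∈ _
      shift (inj₁ z∈)         = inj₁ (there z∈)
      shift (inj₂ (here z≡))  = inj₁ (here z≡)
      shift (inj₂ (there z∈)) = inj₂ z∈

  min-walk-unique : ∀ {used v ws} → MinWalkFrom 𝓕 n G used v ws → Unique ws × (∀ {a} → a ∈ ws → a ∉ used)
  min-walk-unique (stop _) = [] , λ ()
  min-walk-unique (step _ unused _ rest) with min-walk-unique rest
  ... | ws! , fresh = All.tabulate (λ a∈ a≡ → fresh a∈ (here (sym a≡))) ∷ ws! ,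
                      λ { (here refl) → unused ; (there a∈) a∈used → fresh a∈ (there a∈used) }

  min-walk-prefers-smaller : ∀ {used v ws} → MinWalkFrom 𝓕 n G used v ws →
    ∀ pre {x b} post → ws ≡ pre ++ (x , b) ∷ post →
    ∀ b′ → ArcG 𝓕 n G x b′ → (x , b′) ∉ used → (x , b′) ∉ pre → b F.≤ b′
  min-walk-prefers-smaller (stop _) [] _ ()
  min-walk-prefers-smaller (stop _) (_ ∷ _) _ ()
  min-walk-prefers-smaller (step _ _ smallest _) [] post refl b′ b′-arc unused _ = smallest b′ b′-arc unused
  min-walk-prefers-smaller (step _ _ _ rest) (_ ∷ pre) post refl b′ b′-arc unused ∉pre =
    min-walk-prefers-smaller rest pre post refl b′ b′-arc
      (λ { (here eq) → ∉pre (here eq) ; (there b′∈) → unused b′∈ }) (λ b′∈ → ∉pre (there b′∈))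

module Rotation {k : ℕ} (𝓕 : List (Word {k})) (n′ : ℕ) (G : Word {k} → Bool)
  (G-closed : ∀ u v → G u ≡ true → Reach 𝓕 (suc n′) u v → Reach 𝓕 (suc n′) v u → G v ≡ true) where
  open PeriodicWords using (arc?)
  open Arcs 𝓕 n′
  open Walks 𝓕 N G

  arcG? : ∀ u b → Dec (ArcG 𝓕 N G u b)
  arcG? u b = (G u BoolP.≟ true) ×-dec ((G (head u b) BoolP.≟ true) ×-dec arc? 𝓕 N u b)

  -- Since arcs lie on cycles, an arc leaving a vertex of G is an arc of G.
  arc-in-G : ∀ {u b} → G u ≡ true → Arc 𝓕 N u (head u b) → ArcG 𝓕 N G u b
  arc-in-G {u} {b} u∈G arc = u∈G , G-closed u (head u b) u∈G (arc ◅ ε) (arc-returns arc) , arc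

  rotate : ArcT {k} → ArcT {k}
  rotate ([]    , b) = [] , b
  rotate (c ∷ s , b) = s ++ [ b ] , c

  rotate-injective : ∀ {a a′} → rotate a ≡ rotate a′ → a ≡ a′
  rotate-injective {[] , _}    {[] , _}           refl = refl
  rotate-injective {[] , _}    {_ ∷ [] , _}       ()
  rotate-injective {[] , _}    {_ ∷ _ ∷ _ , _}    ()
  rotate-injective {_ ∷ [] , _}    {[] , _}       ()
  rotate-injective {_ ∷ _ ∷ _ , _} {[] , _}       ()
  rotate-injective {c ∷ s , b} {c′ ∷ s′ , b′} eq
    with ListP.∷ʳ-injective s s′ (cong proj₁ eq) | cong proj₂ eq
  ... | refl , refl | refl = refl

  rotate-arc : ∀ {a} → IsArc a → IsArc (rotate a) × proj₁ (rotate a) ≡ target a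
  rotate-arc {[] , _}    (_ , _ , (_ , _ , _ , () , _))
  rotate-arc {c ∷ s , b} (_ , head∈G , arc) = arc-in-G head∈G (arc-rotates arc) , refl

  Saturated : Word {k} → List (ArcT {k}) → Set
  Saturated y ws = ∀ b → ArcG 𝓕 N G y b → (y , b) ∈ ws

  -- For a repetition-free list ws of arcs of G and a saturated vertex y,
  -- rotation embeds the arcs of ws entering y into those leaving y.
  module Saturation {ws : List (ArcT {k})} (ws! : Unique ws) (ws-arcs : ∀ {a} → a ∈ ws → IsArc a)
                    {y : Word {k}} (y-saturated : Saturated y ws) where

    rotation-used : ∀ {a} → IsArc a → target a ≡ y → rotate a ∈ leaving y ws
    rotation-used a-arc a↦y with rotate-arc a-arc
    ... | rot-arc , rot-leaves = ∈-filter⁺ (λ r → proj₁ r ≟w y) (used (trans rot-leaves a↦y) rot-arc)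
                                                              (trans rot-leaves a↦y)
      where
        used : ∀ {r} → proj₁ r ≡ y → IsArc r → r ∈ ws
        used {_ , c} refl r-arc = y-saturated c r-arc

    rotated-entering⊆leaving : map rotate (entering y ws) ⊆ leaving y ws
    rotated-entering⊆leaving z∈ with ∈-map⁻ rotate z∈
    ... | a , a∈entering , refl with ∈-filter⁻ (λ a → target a ≟w y) a∈entering
    ...   | a∈ws , a↦y = rotation-used (ws-arcs a∈ws) a↦y

    rotated-entering-unique : Unique (map rotate (entering y ws))
    rotated-entering-unique = UniqueP.map⁺ rotate-injective (UniqueP.filter⁺ (λ a → target a ≟w y) ws!)

    indegree≤outdegree : length (entering y ws) ≤ length (leaving y ws)
    indegree≤outdegree = subst (_≤ length (leaving y ws)) (ListP.length-map rotate (entering y ws))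
      (unique⊆⇒length≤ rotated-entering-unique rotated-entering⊆leaving)

    -- An unused arc of G entering y makes the inequality strict: its rotation
    -- leaves y but is not the rotation of a used arc.
    unused-entering⇒indegree<outdegree : ∀ {a} → IsArc a → target a ≡ y → a ∉ ws →
                                         length (entering y ws) < length (leaving y ws)
    unused-entering⇒indegree<outdegree {a} a-arc a↦y a∉ws =
      subst (_< length (leaving y ws)) (ListP.length-map rotate (entering y ws))
        (unique⊆⇒length< rotated-entering-unique rotated-entering⊆leaving
                          (rotation-used a-arc a↦y) rot∉image)
      where
        rot∉image : rotate a ∉ map rotate (entering y ws)
        rot∉image rot∈ with ∈-map⁻ rotate rot∈
        ... | a′ , a′∈ , eq = a∉ws (subst (_∈ ws) (sym (rotate-injective eq))
                                          (proj₁ (∈-filter⁻ (λ a → target a ≟w y) a′∈)))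

module MinimalWalk {k : ℕ} (𝓕 : List (Word {k})) (n′ : ℕ) (G : Word {k} → Bool)
  (G-closed : ∀ u v → G u ≡ true → Reach 𝓕 (suc n′) u v → Reach 𝓕 (suc n′) v u → G v ≡ true)
  (G-length : ∀ u → G u ≡ true → length u ≡ suc n′)
  (m : Word {k}) (m∈G : G m ≡ true) {ws : List (ArcT {k})} (mw : IsMinimalWalk 𝓕 (suc n′) G m ws) where
  open Arcs 𝓕 n′ using (N)
  open Walks 𝓕 N G
  open Rotation 𝓕 n′ G G-closed

  end : Word {k}
  end = proj₁ (min-walk-end mw)

  walk : Walk 𝓕 N G m ws end
  walk = proj₁ (proj₂ (min-walk-end mw))

  end-saturated : Saturated end ws
  end-saturated b arc with proj₂ (proj₂ (min-walk-end mw)) b arc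
  ... | inj₁ used = used
  ... | inj₂ ()

  ws! : Unique ws
  ws! = proj₁ (min-walk-unique mw)

  ws-arcs : ∀ {a} → a ∈ ws → IsArc a
  ws-arcs = walk-arcs walk

  _∈ws? : ∀ a → Dec (a ∈ ws)
  a ∈ws? = Any.any? (ProductP.≡-dec _≟w_ FinP._≟_ a) ws

  -- The minimal walk is closed: if it stopped at end ≠ m, then end would be
  -- entered once more than left, although end is saturated.
  closed : end ≡ m
  closed with end ≟w m
  ... | yes end≡m = end≡m
  ... | no  end≢m = ⊥-elim (ℕP.<⇒≱ more-entered (Saturation.indegree≤outdegree ws! ws-arcs end-saturated))
    where
      balance : length (leaving end ws) + 1 ≡ length (entering end ws) + 0
      balance = subst₂ (λ i j → length (leaving end ws) + i ≡ length (entering end ws) + j)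
                       (⟦⟧-yes (end ≟w end) refl) (⟦⟧-no (m ≟w end) (λ m≡end → end≢m (sym m≡end)))
                       (walk-balance walk end)
      more-entered : length (leaving end ws) < length (entering end ws)
      more-entered = subst₂ _≤_ (ℕP.+-comm _ 1) (ℕP.+-identityʳ _) (ℕP.≤-reflexive balance)

  balanced : ∀ y → length (leaving y ws) ≡ length (entering y ws)
  balanced y = ℕP.+-cancelʳ-≡ _ _ _
    (subst (λ e → length (leaving y ws) + ⟦ e ≟w y ⟧ ≡ length (entering y ws) + ⟦ m ≟w y ⟧) closed
           (walk-balance walk y))

  m-saturated : Saturated m ws
  m-saturated = subst (λ e → Saturated e ws) closed end-saturated

  Open : Word {k} → Set
  Open x = ∃ λ b → ArcG 𝓕 N G x b × (x , b) ∉ ws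

  open-or-saturated : ∀ y → Open y ⊎ Saturated y ws
  open-or-saturated y with FinP.any? (λ c → arcG? y c ×-dec ¬? ((y , c) ∈ws?))
  ... | yes y-open = inj₁ y-open
  ... | no ¬open   = inj₂ used
    where
      used : Saturated y ws
      used c arc with (y , c) ∈ws?
      ... | yes used = used
      ... | no unused = ⊥-elim (¬open (c , arc , unused))

  -- At an open vertex the arc of greatest label is unused: the minimal walk
  -- would have preferred the smaller unused label b.
  greatest-arc-unused : ∀ {x b bm} → ArcG 𝓕 N G x b → (x , b) ∉ ws →
                        (∀ b′ → ArcG 𝓕 N G x b′ → b′ F.≤ bm) → (x , bm) ∉ ws
  greatest-arc-unused {x} {b} {bm} arc unused greatest bm∈ with ∈-∃++ bm∈
  ... | pre , post , ws≡ = unused (subst (λ c → (x , c) ∈ ws) (sym b≡bm) bm∈)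
    where
      b≡bm : b ≡ bm
      b≡bm = FinP.≤-antisym (greatest b arc)
        (min-walk-prefers-smaller mw pre post ws≡ b arc (λ ())
          (λ b∈pre → unused (subst ((x , b) ∈_) (sym ws≡) (∈-++⁺ˡ b∈pre))))

  -- An open vertex x ≠ m has its T-arc e(x), which is unused, so the head of
  -- e(x) is again open: otherwise it would be saturated, and it would be left
  -- more often than entered.
  open-step : ∀ {x} → Open x → ∃ λ y → TArc 𝓕 N G m x y × Open y
  open-step {x} (b , arc , unused) with greatest-witness (arcG? x) (b , arc)
  ... | bm , bm-arc , greatest = head x bm , (bm , x≢m , bm-arc , greatest , refl) , head-open
    where
      x≢m : x ≢ m
      x≢m refl = unused (m-saturated b arc)
      head-open : Open (head x bm)
      head-open with open-or-saturated (head x bm)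
      ... | inj₁ y-open = y-open
      ... | inj₂ y-sat  = ⊥-elim (ℕP.<-irrefl (sym (balanced _))
        (Saturation.unused-entering⇒indegree<outdegree ws! ws-arcs y-sat bm-arc refl
          (greatest-arc-unused arc unused greatest)))

  tree⇒eulerian : IsTree 𝓕 N G m → IsEulerianCycle 𝓕 N G ws
  tree⇒eulerian tree = (m , m∈G , subst (Walk 𝓕 N G m ws) closed walk) , ws! , all-used
    where
      open⊆words : ∀ {x} → Open x → x ∈ allWords N
      open⊆words {x} (_ , (x∈G , _) , _) =
        subst (λ l → x ∈ allWords l) (G-length x x∈G) (allWords-complete x)
      all-used : ∀ u b → ArcG 𝓕 N G u b → (u , b) ∈ ws
      all-used u b arc with (u , b) ∈ws?
      ... | yes used = used
      ... | no unused = ⊥-elim (successor-closed⇒empty (TArc 𝓕 N G m) (λ cycle → tree (_ , cycle))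
                                  Open (allWords N) open⊆words open-step (b , arc , unused))

  LastExit : Word {k} → Fin k → ℕ → Set
  LastExit x b r = ∃₂ λ pre post → ws ≡ pre ++ (x , b) ∷ post × length post ≡ r × (∀ c → (x , c) ∉ post)

  -- Once the walk enters y ≠ m it must leave y again, so the last exit
  -- from y comes after any arc entering y.
  exit-later : ∀ {x b c r r′} → LastExit x b r → LastExit (head x b) c r′ → head x b ≢ m → r′ < r
  exit-later {x} {b} {c} (pre , post , ws≡ , refl , _) (pre′ , post′ , ws≡′ , refl , none′) y≢m
    with walk-leaves (walk-suffix pre post (subst (λ l → Walk 𝓕 N G m l end) ws≡ walk))
                     (λ y≡end → y≢m (trans y≡end closed))
  ... | c₀ , y-leaves = ℕP.≰⇒> λ post≤post′ → none′ c₀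
    (suffix-⊆ (pre ++ [ (x , b) ]) post (pre′ ++ [ (head x b , c) ]) post′
              (trans (sym (after pre ws≡)) (after pre′ ws≡′)) post≤post′ y-leaves)
    where
      after : ∀ p {a q} → ws ≡ p ++ a ∷ q → ws ≡ (p ++ [ a ]) ++ q
      after p {a} {q} eq = trans eq (sym (ListP.++-assoc p [ a ] q))

  first-arc : ∀ {x z} → TransClosure (TArc 𝓕 N G m) x z → ∃ (TArc 𝓕 N G m x)
  first-arc [ s ]⁺    = _ , s
  first-arc (s ∷⁺ _) = _ , s

  module _ (all-used : ∀ u b → ArcG 𝓕 N G u b → (u , b) ∈ ws) where

    -- If the walk uses every arc, the T-arc e(x) is the last exit from x:
    -- a later arc x → c would satisfy both c ≤ e(x) and e(x) ≤ c.
    T-arc-last-exit : ∀ {x y} → (t : TArc 𝓕 N G m x y) → ∃ (LastExit x (proj₁ t))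
    T-arc-last-exit {x} (bm , _ , bm-arc , greatest , _) with ∈-∃++ (all-used x bm bm-arc)
    ... | pre , post , ws≡ = length post , pre , post , ws≡ , refl , no-later-exit
      where
        ws≡! : Unique (pre ++ (x , bm) ∷ post)
        ws≡! = subst Unique ws≡ ws!
        no-later-exit : ∀ c → (x , c) ∉ post
        no-later-exit c c∈post = unique-∉-after pre post ws≡! (subst (λ d → (x , d) ∈ post) c≡bm c∈post)
          where
            c-arc : ArcG 𝓕 N G x c
            c-arc = ws-arcs (subst ((x , c) ∈_) (sym ws≡) (∈-++⁺ʳ pre (there c∈post)))
            c≡bm : c ≡ bm
            c≡bm = FinP.≤-antisym (greatest c c-arc)
              (min-walk-prefers-smaller mw pre post ws≡ c c-arc (λ ())
                (unique-∉-before pre ((x , bm) ∷ post) ws≡! (there c∈post)))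

    -- The rank of a T-arc is the distance of its last exit from the end of the walk.
    rank : ∀ {x} → ∃ (TArc 𝓕 N G m x) → ℕ
    rank (_ , t) = proj₁ (T-arc-last-exit t)

    rank-decreases : ∀ {x y z} (s : TArc 𝓕 N G m x y) (t : TArc 𝓕 N G m y z) → rank (_ , t) < rank (_ , s)
    rank-decreases s@(_ , _ , _ , _ , refl) t@(_ , y≢m , _) =
      exit-later (proj₂ (T-arc-last-exit s)) (proj₂ (T-arc-last-exit t)) y≢m

    rank-descent : ∀ {x z w} (p : TransClosure (TArc 𝓕 N G m) x z) (t : TArc 𝓕 N G m z w) →
                   rank (_ , t) < rank (first-arc p)
    rank-descent [ s ]⁺    t = rank-decreases s t
    rank-descent (s ∷⁺ p) t = ℕP.<-trans (rank-descent p t) (rank-decreases s (proj₂ (first-arc p)))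

  eulerian⇒tree : IsEulerianCycle 𝓕 N G ws → IsTree 𝓕 N G m
  eulerian⇒tree (_ , _ , all-used) (_ , cycle) =
    ℕP.<-irrefl refl (rank-descent all-used cycle (proj₂ (first-arc cycle)))

theorem2 : (k : ℕ) (𝓕 : List (Word {k})) (n : ℕ) → 1 ≤ n →
    (G : Word {k} → Bool) → IsDeBruijn 𝓕 n G →
    (m : Word {k}) → IsLexMax G m →
    (ws : List (ArcT {k})) → IsMinimalWalk 𝓕 n G m ws →
    (IsEulerianCycle 𝓕 n G ws ⇔ IsTree 𝓕 n G m)
theorem2 k 𝓕 (suc n′) _ G ((G-length , _ , _ , G-closed) , _) m (m∈G , _) ws mw =
  mk⇔ eulerian⇒tree tree⇒eulerian
  where open MinimalWalk 𝓕 n′ G G-closed G-length m m∈G mw
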